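{- Let $T^\flat_0=T^\flat$, $T^\flat_{k+1}=T^\flat_k\otimes T^\flat_k$ and $T^\sharp_0=T^\sharp$, $T^\sharp_{k+1}=T^\sharp_k\otimes T^\sharp_k$ for $k\geqslant0$. Then for every integer $k\geqslant 0$: $\alpha(T^\flat_k)=k+2$, $\beta(T^\flat_k)=3\cdot 2^k-1$, $\delta(T^\flat_k)=3\cdot 2^k+k+1$, $g(T^\flat_k)=3\cdot 2^k$, $n(T^\flat_k)=\frac92\cdot 4^k+\frac92\cdot 2^k$; and $\alpha(T^\sharp_k)=k+2$, $\beta(T^\sharp_k)=6\cdot 2^k-1$, $\delta(T^\sharp_k)=6\cdot 2^k+k+1$, $g(T^\sharp_k)=6\cdot 2^k$, $n(T^\sharp_k)=18\cdot 4^k+3\cdot 2^k$.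
   Context: Let $S=\{0,1,*\}$; elements of $S^d$ are strings of length $d$. For $u,v\in S^d$ let $\mathrm{dist}(u,v)$ be the number of positions $i$ with $u_i\neq v_i$ and $u_i,v_i\in\{0,1\}$. A list is a finite sequence of strings all of the same length (repetitions allowed); $|L|$ is its number of entries; $[x]$ is the one-entry list of the string $x$; $*^m$ is the string of $m$ jokers $*$. Operations: pairing $[v_1,\dots,v_n]\ominus[w_1,\dots,w_n]=[v_1w_1,\dots,v_nw_n]$; concatenation $AB=[v_iw_j]$ (all pairs, ordered lexicographically in $(i,j)$); sum $A+B$ = entries of $A$ followed by entries of $B$; $1\cdot A=A$, $(k+1)\cdot A=k\cdot A+A$; concatenation before sum. For a triple of lists $T=(A,B,C)$ with $|A|=|B|$: $\alpha(T)$, $\beta(T)$ are the lengths of the strings in $A$, $B$; $\delta(T)=\alpha(T)+\beta(T)$; $n(T)=|A|$; $g(T)=|C|$. The compound of two triples $T=(A,B,C)$, $T'=(A',B',C')$ with $\alpha(T)=\alpha(T')$ is $T\otimes T'=(A'',B'',C'')$ with $A''=[0]A+[0]A'+[1]\big((g(T)g(T'))\cdot[*^{\alpha(T)}]\big)$, $B''=[0]B[*^{\beta(T')}]+[1][*^{\beta(T)}]B'+[*]CC'$, $C''=[0]C[*^{\beta(T')}]+[1][*^{\beta(T)}]C'$. Let $H=[00,01,1*]$. Define $T^\flat=(A^\flat,B^\flat,C^\flat)$ with $A^\flat=3\cdot[00]+3\cdot[01]+3\cdot[1*]$, $B^\flat=3\cdot H$, $C^\flat=H$; and $T^\sharp=(A^\sharp,B^\sharp,C^\sharp)$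 with $A^\sharp=2\cdot(3\cdot[00]+3\cdot[01])+9\cdot[1*]$, $B^\sharp=2\cdot([0]H[**])+2\cdot([1][**]H)+[*]HH$, $C^\sharp=[0]H[**]+[1][**]H$. -}

module Defs where

open import Data.Nat using (ℕ; zero; suc; _*_)
open import Data.List using (List; []; _∷_; _++_; length; map; concatMap; replicate)
open import Relation.Binary.PropositionalEquality using (_≡_)

-- S = {0,1,*}
data Sym : Set where
  s0 s1 sj : Sym

Str : Set
Str = List Sym

SList : Set
SList = List Str

⟦_⟧ : Str → SList
⟦ x ⟧ = x ∷ []

jokers : ℕ → Str
jokers m = replicate m sj

_·_ : SList → SList → SList
A · B = concatMap (λ v → map (λ w → v ++ w) B) A
infixl 7 _·_

_⊙_ : ℕ → SList → SList
zero ⊙ A = []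
suc k ⊙ A = k ⊙ A ++ A
infixl 6 _⊙_

_⊕_ : SList → SList → SList
A ⊕ B = A ++ B
infixl 5 _⊕_

-- common length of the strings of a list (length of the first entry; 0 for the empty list)
strLen : SList → ℕ
strLen [] = 0
strLen (x ∷ _) = length x

record Triple : Set where
  constructor ⟨_,_,_⟩
  field
    A B C : SList
open Triple public

α β δ n g : Triple → ℕ
α T = strLen (A T)
β T = strLen (B T)
δ T = α T Data.Nat.+ β T
n T = length (A T)
g T = length (C T)

_⊗_ : Triple → Triple → Triple
T ⊗ T' =
  ⟨ ⟦ s0 ∷ [] ⟧ · A T ⊕ ⟦ s0 ∷ [] ⟧ · A T' ⊕ ⟦ s1 ∷ [] ⟧ · ((g T * g T') ⊙ ⟦ jokers (α T) ⟧)
  , ⟦ s0 ∷ [] ⟧ · B T · ⟦ jokers (β T') ⟧ ⊕ ⟦ s1 ∷ [] ⟧ · ⟦ jokers (β T) ⟧ · B T' ⊕ ⟦ sj ∷ [] ⟧ · C T · C T'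
  , ⟦ s0 ∷ [] ⟧ · C T · ⟦ jokers (β T') ⟧ ⊕ ⟦ s1 ∷ [] ⟧ · ⟦ jokers (β T) ⟧ · C T' ⟩

H : SList
H = (s0 ∷ s0 ∷ []) ∷ (s0 ∷ s1 ∷ []) ∷ (s1 ∷ sj ∷ []) ∷ []

Tflat : Triple
Tflat = ⟨ 3 ⊙ ⟦ s0 ∷ s0 ∷ [] ⟧ ⊕ 3 ⊙ ⟦ s0 ∷ s1 ∷ [] ⟧ ⊕ 3 ⊙ ⟦ s1 ∷ sj ∷ [] ⟧
        , 3 ⊙ H
        , H ⟩

Tsharp : Triple
Tsharp = ⟨ 2 ⊙ (3 ⊙ ⟦ s0 ∷ s0 ∷ [] ⟧ ⊕ 3 ⊙ ⟦ s0 ∷ s1 ∷ [] ⟧) ⊕ 9 ⊙ ⟦ s1 ∷ sj ∷ [] ⟧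
         , 2 ⊙ (⟦ s0 ∷ [] ⟧ · H · ⟦ jokers 2 ⟧) ⊕ 2 ⊙ (⟦ s1 ∷ [] ⟧ · ⟦ jokers 2 ⟧ · H) ⊕ ⟦ sj ∷ [] ⟧ · H · H
         , ⟦ s0 ∷ [] ⟧ · H · ⟦ jokers 2 ⟧ ⊕ ⟦ s1 ∷ [] ⟧ · ⟦ jokers 2 ⟧ · H ⟩

iter : Triple → ℕ → Triple
iter T zero = T
iter T (suc k) = iter T k ⊗ iter T k

{-# OPTIONS --safe #-}
module Submission where

open import Defs
open import Data.Nat using (ℕ; zero; suc; _+_; _*_; _∸_; _^_; _<_; _≟_; z<s)
open import Data.Nat.Properties
  using (+-comm; +-identityʳ; *-identityˡ; *-identityʳ; +-suc; +-cancelʳ-≡; *-cancelˡ-≡; m≤n⇒m≤n+o)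
open import Data.Nat.Tactic.RingSolver using (solve-∀)
open import Data.Product using (_×_; _,_)
open import Data.List using ([]; _∷_; _++_; length; map)
open import Data.List.Properties using (length-++; length-map; length-replicate)
open import Data.List.Relation.Unary.All as All using (All; []; _∷_; all?)
open import Data.List.Relation.Unary.All.Properties using (++⁺; map⁺; concat⁺)
open import Relation.Nullary using (Dec)
open import Relation.Nullary.Decidable using (from-yes)
open import Relation.Binary.PropositionalEquality using (_≡_; refl; sym; trans; cong; cong₂; subst; module ≡-Reasoning)

open ≡-Reasoning

-- Compounding a triple with itself doubles g and sends n to 2n + g²; if the strings of A
-- have length a and those of B and C length b, the compound has lengths a + 1 and 2b + 1.
-- Iterating from T♭ (a = b = 2, n = 9, g = 3) and T♯ (a = 2, b = 5, n = 21, g = 6) and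
-- solving these recurrences gives the formulas.

length-· : ∀ X Y → length (X · Y) ≡ length X * length Y
length-· []      Y = refl
length-· (x ∷ X) Y = begin
  length (map (x ++_) Y ++ X · Y)         ≡⟨ length-++ (map (x ++_) Y) ⟩
  length (map (x ++_) Y) + length (X · Y) ≡⟨ cong₂ _+_ (length-map (x ++_) Y) (length-· X Y) ⟩
  length Y + length X * length Y          ∎

length-[x]· : ∀ x Y → length (⟦ x ⟧ · Y) ≡ length Y
length-[x]· x Y = trans (length-· ⟦ x ⟧ Y) (*-identityˡ (length Y))

length-·[x] : ∀ X y → length (X · ⟦ y ⟧) ≡ length X
length-·[x] X y = trans (length-· X ⟦ y ⟧) (*-identityʳ (length X))

length-⊙[x] : ∀ k x → length (k ⊙ ⟦ x ⟧) ≡ k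
length-⊙[x] zero    x = refl
length-⊙[x] (suc k) x = begin
  length (k ⊙ ⟦ x ⟧ ++ ⟦ x ⟧) ≡⟨ length-++ (k ⊙ ⟦ x ⟧) ⟩
  length (k ⊙ ⟦ x ⟧) + 1     ≡⟨ cong (_+ 1) (length-⊙[x] k x) ⟩
  k + 1                      ≡⟨ +-comm k 1 ⟩
  suc k                      ∎

g-⊗ : ∀ T T′ → g (T ⊗ T′) ≡ g T + g T′
g-⊗ T T′ = trans (length-++ (⟦ s0 ∷ [] ⟧ · C T · ⟦ jokers (β T′) ⟧))
  (cong₂ _+_ (trans (length-·[x] (⟦ s0 ∷ [] ⟧ · C T) _) (length-[x]· _ (C T)))
             (trans (length-· (⟦ s1 ∷ [] ⟧ · ⟦ jokers (β T) ⟧) (C T′)) (+-identityʳ (g T′))))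

n-⊗ : ∀ T T′ → n (T ⊗ T′) ≡ n T + n T′ + g T * g T′
n-⊗ T T′ = trans (length-++ (⟦ s0 ∷ [] ⟧ · A T ⊕ ⟦ s0 ∷ [] ⟧ · A T′))
  (cong₂ _+_ (trans (length-++ (⟦ s0 ∷ [] ⟧ · A T)) (cong₂ _+_ (length-[x]· _ (A T)) (length-[x]· _ (A T′))))
             (trans (length-[x]· (s1 ∷ []) ((g T * g T′) ⊙ ⟦ jokers (α T) ⟧)) (length-⊙[x] (g T * g T′) _)))

length-B-⊗ : ∀ T T′ → length (B (T ⊗ T′)) ≡ length (B T) + length (B T′) + g T * g T′
length-B-⊗ T T′ = trans (length-++ (⟦ s0 ∷ [] ⟧ · B T · ⟦ jokers (β T′) ⟧ ⊕ ⟦ s1 ∷ [] ⟧ · ⟦ jokers (β T) ⟧ · B T′))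
  (cong₂ _+_ (trans (length-++ (⟦ s0 ∷ [] ⟧ · B T · ⟦ jokers (β T′) ⟧))
               (cong₂ _+_ (trans (length-·[x] (⟦ s0 ∷ [] ⟧ · B T) _) (length-[x]· _ (B T)))
                          (trans (length-· (⟦ s1 ∷ [] ⟧ · ⟦ jokers (β T) ⟧) (B T′)) (+-identityʳ _))))
             (trans (length-· (⟦ sj ∷ [] ⟧ · C T) (C T′)) (cong (_* g T′) (length-[x]· _ (C T)))))

Uniform : ℕ → SList → Set
Uniform m = All (λ s → length s ≡ m)

uniform? : ∀ m L → Dec (Uniform m L)
uniform? m = all? (λ s → length s ≟ m)

[x]-uniform : ∀ x → Uniform (length x) ⟦ x ⟧
[x]-uniform x = refl ∷ []

jokers-uniform : ∀ {m k} → m ≡ k → Uniform k ⟦ jokers m ⟧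
jokers-uniform {m} m≡k = trans (length-replicate m) m≡k ∷ []

·-uniform : ∀ {a b X Y} → Uniform a X → Uniform b Y → Uniform (a + b) (X · Y)
·-uniform {Y = Y} uX uY = concat⁺ (map⁺ (All.map (λ {x} |x|≡a → map⁺ (All.map (append x |x|≡a) uY)) uX))
  where
  append : ∀ {a b} x → length x ≡ a → ∀ {y} → length y ≡ b → length (x ++ y) ≡ a + b
  append x |x|≡a |y|≡b = trans (length-++ x) (cong₂ _+_ |x|≡a |y|≡b)

⊙-uniform : ∀ {a X} k → Uniform a X → Uniform a (k ⊙ X)
⊙-uniform zero    uX = []
⊙-uniform (suc k) uX = ++⁺ (⊙-uniform k uX) uX

strLen-uniform : ∀ {m L} → Uniform m L → 0 < length L → strLen L ≡ m
strLen-uniform (|x|≡m ∷ _) _ = |x|≡m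

-- Nonemptiness is needed because α and β read the length off the first entry.
record Shaped (a b : ℕ) (T : Triple) : Set where
  field
    A-uniform  : Uniform a (A T)
    B-uniform  : Uniform b (B T)
    C-uniform  : Uniform b (C T)
    A-nonempty : 0 < n T
    B-nonempty : 0 < length (B T)

  α-shaped : α T ≡ a
  α-shaped = strLen-uniform A-uniform A-nonempty

  β-shaped : β T ≡ b
  β-shaped = strLen-uniform B-uniform B-nonempty
open Shaped

⊗-shaped : ∀ {a b b′ T T′} → Shaped a b T → Shaped a b′ T′ → Shaped (suc a) (suc (b + b′)) (T ⊗ T′)
⊗-shaped {b = b} {b′} {T} {T′} S S′ = record
  { A-uniform  = ++⁺ (++⁺ (prefix (A-uniform S)) (prefix (A-uniform S′)))
                     (prefix (⊙-uniform (g T * g T′) (jokers-uniform (α-shaped S))))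
  ; B-uniform  = ++⁺ (++⁺ (padRight (B-uniform S)) (padLeft (B-uniform S′)))
                     (·-uniform (prefix (C-uniform S)) (C-uniform S′))
  ; C-uniform  = ++⁺ (padRight (C-uniform S)) (padLeft (C-uniform S′))
  ; A-nonempty = subst (0 <_) (sym (n-⊗ T T′)) (m≤n⇒m≤n+o _ (m≤n⇒m≤n+o _ (A-nonempty S)))
  ; B-nonempty = subst (0 <_) (sym (length-B-⊗ T T′)) (m≤n⇒m≤n+o _ (m≤n⇒m≤n+o _ (B-nonempty S)))
  }
  where
  prefix : ∀ {c X} {x : Sym} → Uniform c X → Uniform (suc c) (⟦ x ∷ [] ⟧ · X)
  prefix = ·-uniform ([x]-uniform _)
  padRight : ∀ {X} → Uniform b X → Uniform (suc (b + b′)) (⟦ s0 ∷ [] ⟧ · X · ⟦ jokers (β T′) ⟧)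
  padRight uX = ·-uniform (prefix uX) (jokers-uniform (β-shaped S′))
  padLeft : ∀ {X} → Uniform b′ X → Uniform (suc (b + b′)) (⟦ s1 ∷ [] ⟧ · ⟦ jokers (β T) ⟧ · X)
  padLeft uX = ·-uniform (prefix (jokers-uniform (β-shaped S))) uX

m*n+m*n≡m*[2*n] : ∀ m n → m * n + m * n ≡ m * (2 * n)
m*n+m*n≡m*[2*n] = solve-∀

compoundWidth : ℕ → ℕ → ℕ
compoundWidth b zero    = b
compoundWidth b (suc k) = suc (compoundWidth b k + compoundWidth b k)

suc-compoundWidth : ∀ b k → suc (compoundWidth b k) ≡ suc b * 2 ^ k
suc-compoundWidth b zero    = sym (*-identityʳ (suc b))
suc-compoundWidth b (suc k) = begin
  suc (suc (w + w))                 ≡⟨ cong suc (sym (+-suc w w)) ⟩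
  suc w + suc w                     ≡⟨ cong (λ v → v + v) (suc-compoundWidth b k) ⟩
  suc b * 2 ^ k + suc b * 2 ^ k     ≡⟨ m*n+m*n≡m*[2*n] (suc b) (2 ^ k) ⟩
  suc b * 2 ^ suc k                 ∎
  where
  w : ℕ
  w = compoundWidth b k

iter-shaped : ∀ {a b T} → Shaped a b T → ∀ k → Shaped (k + a) (compoundWidth b k) (iter T k)
iter-shaped S zero    = S
iter-shaped S (suc k) = ⊗-shaped (iter-shaped S k) (iter-shaped S k)

α-iter : ∀ {a b T} → Shaped a b T → ∀ k → α (iter T k) ≡ k + a
α-iter S k = α-shaped (iter-shaped S k)

suc-β-iter : ∀ {a b T} → Shaped a b T → ∀ k → suc (β (iter T k)) ≡ suc b * 2 ^ k
suc-β-iter {b = b} S k = trans (cong suc (β-shaped (iter-shaped S k))) (suc-compoundWidth b k)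

β-iter : ∀ {a b T} → Shaped a b T → ∀ k → β (iter T k) ≡ suc b * 2 ^ k ∸ 1
β-iter S k = cong (_∸ 1) (suc-β-iter S k)

δ-iter : ∀ {a b T} → Shaped (suc a) b T → ∀ k → δ (iter T k) ≡ suc b * 2 ^ k + k + a
δ-iter {a} {b} {T} S k = begin
  α (iter T k) + β (iter T k)   ≡⟨ cong (_+ β (iter T k)) (α-iter S k) ⟩
  k + suc a + β (iter T k)      ≡⟨ rearrange k a (β (iter T k)) ⟩
  suc (β (iter T k)) + k + a    ≡⟨ cong (λ v → v + k + a) (suc-β-iter S k) ⟩
  suc b * 2 ^ k + k + a         ∎
  where
  rearrange : ∀ k a w → k + suc a + w ≡ suc w + k + a
  rearrange = solve-∀

g-iter : ∀ T k → g (iter T k) ≡ g T * 2 ^ k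
g-iter T zero    = sym (*-identityʳ (g T))
g-iter T (suc k) = begin
  g (iter T k ⊗ iter T k)       ≡⟨ g-⊗ (iter T k) (iter T k) ⟩
  g (iter T k) + g (iter T k)   ≡⟨ cong (λ v → v + v) (g-iter T k) ⟩
  g T * 2 ^ k + g T * 2 ^ k     ≡⟨ m*n+m*n≡m*[2*n] (g T) (2 ^ k) ⟩
  g T * 2 ^ suc k               ∎

4^n≡2^n*2^n : ∀ k → 4 ^ k ≡ 2 ^ k * 2 ^ k
4^n≡2^n*2^n zero    = refl
4^n≡2^n*2^n (suc k) = trans (cong (4 *_) (4^n≡2^n*2^n k)) (square-double (2 ^ k))
  where
  square-double : ∀ x → 4 * (x * x) ≡ (2 * x) * (2 * x)
  square-double = solve-∀

-- 2 n(T_k) = 2^(k+1) n(T) + g(T)² 2^k (2^k − 1), stated without subtraction.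
n-iter : ∀ T k → 2 * n (iter T k) + g T * g T * 2 ^ k ≡ 2 * n T * 2 ^ k + g T * g T * 4 ^ k
n-iter T zero    = cong (_+ g T * g T * 1) (sym (*-identityʳ (2 * n T)))
n-iter T (suc k) = begin
  2 * n (Tₖ ⊗ Tₖ) + G² * (2 * x)
    ≡⟨ cong (λ v → 2 * v + G² * (2 * x)) (n-⊗ Tₖ Tₖ) ⟩
  2 * (n Tₖ + n Tₖ + g Tₖ * g Tₖ) + G² * (2 * x)
    ≡⟨ cong (λ v → 2 * (n Tₖ + n Tₖ + v * v) + G² * (2 * x)) (g-iter T k) ⟩
  2 * (n Tₖ + n Tₖ + g T * x * (g T * x)) + G² * (2 * x)
    ≡⟨ regroup (n Tₖ) (g T) x ⟩
  2 * (2 * n Tₖ + G² * x) + 2 * (G² * (x * x))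
    ≡⟨ cong₂ (λ u v → 2 * u + 2 * (G² * v)) (n-iter T k) (sym (4^n≡2^n*2^n k)) ⟩
  2 * (2 * n T * x + G² * 4 ^ k) + 2 * (G² * 4 ^ k)
    ≡⟨ collect (n T) G² x (4 ^ k) ⟩
  2 * n T * (2 * x) + G² * (4 * 4 ^ k)
    ∎
  where
  Tₖ : Triple
  Tₖ = iter T k
  G² x : ℕ
  G² = g T * g T
  x = 2 ^ k
  regroup : ∀ m h x → 2 * (m + m + h * x * (h * x)) + h * h * (2 * x) ≡ 2 * (2 * m + h * h * x) + 2 * (h * h * (x * x))
  regroup = solve-∀
  collect : ∀ m h x y → 2 * (2 * m * x + h * y) + 2 * (h * y) ≡ 2 * m * (2 * x) + h * (4 * y)
  collect = solve-∀

Tflat-shaped : Shaped 2 2 Tflat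
Tflat-shaped = record
  { A-uniform  = from-yes (uniform? 2 (A Tflat))
  ; B-uniform  = from-yes (uniform? 2 (B Tflat))
  ; C-uniform  = from-yes (uniform? 2 (C Tflat))
  ; A-nonempty = z<s
  ; B-nonempty = z<s
  }

Tsharp-shaped : Shaped 2 5 Tsharp
Tsharp-shaped = record
  { A-uniform  = from-yes (uniform? 2 (A Tsharp))
  ; B-uniform  = from-yes (uniform? 5 (B Tsharp))
  ; C-uniform  = from-yes (uniform? 5 (C Tsharp))
  ; A-nonempty = z<s
  ; B-nonempty = z<s
  }

n-iter-Tflat : ∀ k → 2 * n (iter Tflat k) ≡ 9 * 4 ^ k + 9 * 2 ^ k
n-iter-Tflat k = +-cancelʳ-≡ (9 * 2 ^ k) _ _ (trans (n-iter Tflat k) (rearrange (2 ^ k) (4 ^ k)))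
  where
  rearrange : ∀ x y → 2 * 9 * x + 9 * y ≡ 9 * y + 9 * x + 9 * x
  rearrange = solve-∀

n-iter-Tsharp : ∀ k → n (iter Tsharp k) ≡ 18 * 4 ^ k + 3 * 2 ^ k
n-iter-Tsharp k = *-cancelˡ-≡ _ _ 2 (+-cancelʳ-≡ (36 * 2 ^ k) _ _ (trans (n-iter Tsharp k) (rearrange (2 ^ k) (4 ^ k))))
  where
  rearrange : ∀ x y → 2 * 21 * x + 36 * y ≡ 2 * (18 * y + 3 * x) + 36 * x
  rearrange = solve-∀

proposition6 : (k : ℕ) →
    (α (iter Tflat k) ≡ k + 2 × β (iter Tflat k) ≡ 3 * 2 ^ k ∸ 1 × δ (iter Tflat k) ≡ 3 * 2 ^ k + k + 1
      × g (iter Tflat k) ≡ 3 * 2 ^ k × 2 * n (iter Tflat k) ≡ 9 * 4 ^ k + 9 * 2 ^ k)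
    × (α (iter Tsharp k) ≡ k + 2 × β (iter Tsharp k) ≡ 6 * 2 ^ k ∸ 1 × δ (iter Tsharp k) ≡ 6 * 2 ^ k + k + 1
      × g (iter Tsharp k) ≡ 6 * 2 ^ k × n (iter Tsharp k) ≡ 18 * 4 ^ k + 3 * 2 ^ k)
proposition6 k =
  ( α-iter Tflat-shaped k , β-iter Tflat-shaped k , δ-iter Tflat-shaped k , g-iter Tflat k , n-iter-Tflat k )
  , ( α-iter Tsharp-shaped k , β-iter Tsharp-shaped k , δ-iter Tsharp-shaped k , g-iter Tsharp k , n-iter-Tsharp k )
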